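{- Let $(L,\preceq)$ be a finite lattice, $f:L\to L$ an increasing isotone map, and $s\in L$. The order-dual adaptation of Algorithm 1 (described below) enumerates all fixed points of $f$ succeeding $s$, with a delay of at most $h(\operatorname{Fix}(f),\preceq)\cdot\operatorname{ucv}(L,\preceq)$ queries for limits under $f$ plus $\mathcal O\big(h(\operatorname{Fix}(f),\preceq)^2\operatorname{ucv}(L,\preceq)\operatorname{size}(L)\big)$ additional steps, and requires $\mathcal O\big(h(\operatorname{Fix}(f),\preceq)\operatorname{size}(L)\big)$ space.
   Context: A map $f$ is isotone if $x\preceq y\Rightarrow f(x)\preceq f(y)$ and increasing if $x\preceq f(x)$ for all $x$. $\operatorname{Fix}(f)$ is the set of fixed points, a lattice under $\preceq$. Height $h$ is the maximum length $|C|-1$ of a chain $C$. $x\lessdot y$ means $y$ covers $x$. $\operatorname{ucv}(L,\preceq)$ is the maximum number of upper covers of an element. $\operatorname{size}(L)$ is the space needed to represent a lattice element. $f^*(x)=\lim_{t\to\infty}f^{(t)}(x)$, the least fixed point succeeding $x$. $\sqsubseteq_{\mathrm{lex}}$ is a fixed total order on $L$. The adapted algorithm: call SEARCH$(f^*(s),\emptyset,\emptyset)$ where SEARCH$(x,P,D)$: output $x$; $E\gets\emptyset$; for each upper cover $y$ of $x$ in $\sqsubseteq_{\mathrm{lex}}$ order: $z\gets f^*(y)$; if for all $(u,v)\in D\cup E$ and all upper covers $w$ of $u$ with $w\sqsubseteq_{\mathrm{lex}}v$ we have $w\not\preceq z$, then call SEARCH$(z,P\cup\{x\},D\cup E)$;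 then $E\gets\{(x,y)\}$. (This is Algorithm 1 run on the dual lattice $(L,\succeq)$.) Assumptions: upper covers are listable in $\sqsubseteq_{\mathrm{lex}}$ order in $\mathcal O(\operatorname{ucv}(L,\preceq)\operatorname{size}(L))$ time, the dual region test takes $\mathcal O(\operatorname{size}(L))$ time, these use $\mathcal O(\operatorname{size}(L))$ extra space, and memory for $D$ is shared among recursive calls. Each limit computation counts as one query. -}

module Defs where

open import Level using (0ℓ)
open import Data.Bool using (Bool; true; false; _∧_; _∨_; not; if_then_else_)
open import Data.Nat using (ℕ; zero; suc; _+_; _*_; _≤_; _≤ᵇ_)
open import Data.Product using (_×_; _,_; Σ; ∃; ∃-syntax)
open import Data.List using (List; []; _∷_; _++_; length; map; filterᵇ; [_]; replicate)
open import Data.Bool.ListAction using (any; all)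
open import Data.List.Membership.Propositional using (_∈_)
open import Data.List.Relation.Unary.All using (All)
open import Data.List.Relation.Unary.Linked using (Linked)
open import Data.List.Relation.Unary.Unique.Propositional using (Unique)
open import Relation.Binary using (Rel; Decidable; IsPartialOrder)
open import Relation.Binary.Lattice.Structures using (IsLattice)
open import Relation.Binary.PropositionalEquality using (_≡_; _≢_)
open import Relation.Nullary using (¬_; does)
open import Algebra.Core using (Op₂)

record FinLattice : Set₁ where
  field
    Carrier   : Set
    _≼_       : Rel Carrier 0ℓ
    _⊔_       : Op₂ Carrier
    _⊓_       : Op₂ Carrier
    isLattice : IsLattice _≡_ _≼_ _⊔_ _⊓_
    _≼?_      : Decidable _≼_
    elems     : List Carrier
    complete  : ∀ x → x ∈ elems

module _ (L : FinLattice) where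
  open FinLattice L

  _≺_ : Rel Carrier 0ℓ
  x ≺ y = x ≼ y × x ≢ y

  _⋖_ : Rel Carrier 0ℓ
  x ⋖ y = x ≺ y × ¬ (∃[ z ] (x ≺ z × z ≺ y))

  Isotone : (Carrier → Carrier) → Set
  Isotone f = ∀ {x y} → x ≼ y → f x ≼ f y

  Increasing : (Carrier → Carrier) → Set
  Increasing f = ∀ x → x ≼ f x

  IsFixed : (Carrier → Carrier) → Carrier → Set
  IsFixed f x = f x ≡ x

  IsFixChain : (Carrier → Carrier) → List Carrier → Set
  IsFixChain f C = All (IsFixed f) C × Linked _≺_ C

  FixHeight : (Carrier → Carrier) → ℕ → Set
  FixHeight f h =
    (∃[ C ] (IsFixChain f C × length C ≡ suc h)) ×
    (∀ C → IsFixChain f C → length C ≤ suc h)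

  Ucv : ℕ → Set
  Ucv u =
    (∃[ x ] ∃[ ys ] (Unique ys × All (x ⋖_) ys × length ys ≡ u)) ×
    (∀ x ys → Unique ys → All (x ⋖_) ys → length ys ≤ u)

  EnumeratesFixAbove : (Carrier → Carrier) → Carrier → List Carrier → Set
  EnumeratesFixAbove f s out =
    Unique out ×
    All (λ x → IsFixed f x × s ≼ x) out ×
    (∀ x → IsFixed f x → s ≼ x → x ∈ out)

  leqᵇ : Carrier → Carrier → Bool
  leqᵇ x y = does (x ≼? y)

  ltᵇ : Carrier → Carrier → Bool
  ltᵇ x y = leqᵇ x y ∧ not (leqᵇ y x)

  eqᵇ : Carrier → Carrier → Bool
  eqᵇ x y = leqᵇ x y ∧ leqᵇ y x

  coverᵇ : Carrier → Carrier → Bool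
  coverᵇ x y = ltᵇ x y ∧ not (any (λ z → ltᵇ x z ∧ ltᵇ z y) elems)

  -- f*(x) = f^(t)(x) for t = |L| (the sequence is stationary by then)
  iter : (Carrier → Carrier) → ℕ → Carrier → Carrier
  iter f zero    x = x
  iter f (suc n) x = f (iter f n x)

  fstar : (Carrier → Carrier) → Carrier → Carrier
  fstar f x = iter f (length elems) x

  -- Trace events: an output, a limit query, k units of work (steps),
  -- and a snapshot of the memory in use (in units).
  data Event : Set where
    output : Carrier → Event
    query  : Event
    work   : ℕ → Event
    memory : ℕ → Event

  -- Parameters: the total order ⊑lex given as a list 'lex' (position order),
  -- f, u = ucv (cost of listing covers is u·σ), σ = size(L).
  module Algorithm (lex : List Carrier) (f : Carrier → Carrier) (u σ : ℕ) where

    pos : Carrier → ℕ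
    pos = go lex
      where
      go : List Carrier → Carrier → ℕ
      go []       x = 0
      go (y ∷ ys) x = if eqᵇ x y then 0 else suc (go ys x)

    lexᵇ : Carrier → Carrier → Bool
    lexᵇ w v = pos w ≤ᵇ pos v

    ucovers : Carrier → List Carrier
    ucovers x = filterᵇ (coverᵇ x) lex

    regionOK : List (Carrier × Carrier) → Carrier → Bool
    regionOK DE z =
      all (λ { (u' , v) → all (λ w → not (lexᵇ w v ∧ leqᵇ w z)) (ucovers u') }) DE

    -- SEARCH(x, P, D) with fuel; 'depth' = |P| (the recursion stack)
    search : ℕ → ℕ → Carrier → List (Carrier × Carrier) → List Event
    search zero    depth x D = []
    search (suc n) depth x D =
      output x ∷ work σ ∷ memory ((suc depth + length D) * σ) ∷ work (u * σ) ∷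
      loop (ucovers x) []
      where
      loop : List Carrier → List (Carrier × Carrier) → List Event
      loop []       E = []
      loop (y ∷ ys) E =
        query ∷ work σ ∷
        (replicate (length (D ++ E)) (work σ) ++
         ((if regionOK (D ++ E) (fstar f y)
             then search n (suc depth) (fstar f y) (D ++ E)
             else []) ++
          (work σ ∷ loop ys [ (x , y) ])))

    -- the call SEARCH(f*(s), ∅, ∅)  (the query f*(s) itself is preprocessing)
    run : Carrier → List Event
    run s = search (suc (length elems)) 0 (fstar f s) []

  outputs : List Event → List Carrier
  outputs []             = []
  outputs (output x ∷ t) = x ∷ outputs t
  outputs (_ ∷ t)        = outputs t

  memories : List Event → List ℕ
  memories []             = []
  memories (memory k ∷ t) = k ∷ memories t
  memories (_ ∷ t)        = memories t

  -- a segment of a trace between outputs: (#queries, #steps)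
  -- gaps t : list of segments: before the first output, between consecutive
  -- outputs, and after the last output
  Seg : Set
  Seg = ℕ × ℕ

  gaps : List Event → List Seg
  gaps t = go t 0 0
    where
    go : List Event → ℕ → ℕ → List Seg
    go []             q w = (q , w) ∷ []
    go (output _ ∷ t) q w = (q , w) ∷ go t 0 0
    go (query ∷ t)    q w = go t (suc q) w
    go (work k ∷ t)   q w = go t q (k + w)
    go (memory _ ∷ t) q w = go t q w

module Submission where

-- SEARCH explores a tree of fixed points: the children of x are the closures
-- f*(y) of its upper covers y, and a child is entered only if it lies outside
-- the regions of D ∪ E, i.e. above no upper cover w of a with w ⊑lex v for a
-- recorded pair (a , v).  A fixed point z ≠ x above x lies above a ⊑lex-first
-- cover y of x and is reached through the child f*(y) only: no earlier cover
-- lies below it, so no region excludes it there, while every later branch does.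
-- Fixed points strictly increase along a branch, so the recursion depth is at
-- most h and |D| ≤ h.  This bounds the work of a loop iteration and the memory
-- by O(h σ), and everything between two outputs by the unfinished loops of at
-- most h stack frames.

open import Defs
open import Data.Nat using (ℕ; _+_; _*_; _≤_)
open import Data.Product using (_×_; _,_; ∃-syntax)
open import Data.List using (List)
open import Data.List.Membership.Propositional using (_∈_)
open import Data.List.Relation.Unary.All using (All)
open import Data.List.Relation.Unary.Unique.Propositional using (Unique)

open import Data.Nat using (zero; suc; _<_; z≤n; s≤s; _∸_)
open import Data.Nat.Properties
  using (≤-refl; ≤-reflexive; ≤-trans; ≤-pred; <-irrefl; <-≤-trans; <⇒≤; ≤ᵇ⇒≤; ≤⇒≤ᵇ;
         +-assoc; +-comm; +-suc; +-identityʳ; *-assoc; *-identityˡ;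
         +-mono-≤; +-monoˡ-≤; +-monoʳ-≤; *-monoˡ-≤; m≤m+n; m≤n+m; n≤1+n; m<m+n; m∸n+n≡m)
open import Data.Bool using (Bool; true; false; _∧_; not; if_then_else_; T; T?)
open import Data.Bool.Properties using (∧-assoc; T-≡)
open import Data.Bool.ListAction using (any; all)
open import Data.Product using (proj₁; proj₂; Σ)
open import Data.Sum using (inj₁; inj₂)
open import Data.Empty using (⊥-elim)
open import Data.List using ([]; _∷_; _++_; length; replicate; [_])
open import Data.List.Properties using (++-assoc; ++-identityʳ; length-++)
open import Data.List.Relation.Unary.Any using (Any; here; there; any?; satisfied)
open import Data.List.Relation.Unary.All using ([]; _∷_; tabulate)
  renaming (lookup to All-lookup; map to All-map)
open import Data.List.Relation.Unary.All.Properties using () renaming (++⁺ to All-++⁺)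
open import Data.List.Relation.Unary.AllPairs using (AllPairs; []; _∷_)
  renaming (map to AllPairs-map)
open import Data.List.Relation.Unary.AllPairs.Properties using ()
  renaming (filter⁺ to AllPairs-filter⁺)
open import Data.List.Relation.Unary.Linked using (Linked; [-]; _∷_)
open import Data.List.Relation.Unary.Linked.Properties using (Linked⇒AllPairs)
open import Data.List.Relation.Unary.Unique.Propositional.Properties using ()
  renaming (filter⁺ to Unique-filter⁺; ++⁺ to Unique-++⁺)
open import Data.List.Relation.Binary.Subset.Propositional using (_⊆_)
open import Data.List.Membership.Propositional using (find; lose)
open import Data.List.Membership.Propositional.Properties
  using (∈-++⁺ˡ; ∈-++⁺ʳ; ∈-++⁻; ∈-filter⁻; ∈-filter⁺)
open import Data.Nat.Solver using (module +-*-Solver)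
open import Function.Bundles using (Equivalence; _⇔_; mk⇔)
open import Relation.Binary.PropositionalEquality
  using (_≡_; _≢_; refl; sym; trans; cong; subst; subst₂)
open import Relation.Nullary using (¬_; Dec; yes; no)
open import Relation.Nullary.Decidable using (_×-dec_)
open import Relation.Binary.Lattice.Structures using (IsLattice)
open import Relation.Binary.Structures using (IsPartialOrder)

∧≡true⁻ : ∀ {a b} → a ∧ b ≡ true → a ≡ true × b ≡ true
∧≡true⁻ {true} {true} _ = refl , refl

∧≡true⁺ : ∀ {a b} → a ≡ true → b ≡ true → a ∧ b ≡ true
∧≡true⁺ refl refl = refl

not≡true⁻ : ∀ {a} → not a ≡ true → a ≡ false
not≡true⁻ {false} _ = refl

true≢false : true ≢ false
true≢false ()

module _ {A : Set} where

  any≡true⁻ : (p : A → Bool) → ∀ xs → any p xs ≡ true → ∃[ w ] (w ∈ xs × p w ≡ true)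
  any≡true⁻ p (x ∷ xs) e with p x in px
  ... | true  = x , here refl , px
  ... | false with any≡true⁻ p xs e
  ... | w , w∈xs , pw = w , there w∈xs , pw

  any≡false⁻ : (p : A → Bool) → ∀ xs → any p xs ≡ false → ∀ {w} → w ∈ xs → p w ≡ false
  any≡false⁻ p (x ∷ xs) e (here refl) with p x
  ... | false = refl
  any≡false⁻ p (x ∷ xs) e (there w∈xs) with p x
  ... | false = any≡false⁻ p xs e w∈xs

  all≡true⁻ : (p : A → Bool) → ∀ xs → all p xs ≡ true → ∀ {w} → w ∈ xs → p w ≡ true
  all≡true⁻ p (x ∷ xs) e (here refl)  = proj₁ (∧≡true⁻ e)
  all≡true⁻ p (x ∷ xs) e (there w∈xs) = all≡true⁻ p xs (proj₂ (∧≡true⁻ e)) w∈xs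

  all≡true⁺ : (p : A → Bool) → ∀ xs → (∀ {w} → w ∈ xs → p w ≡ true) → all p xs ≡ true
  all≡true⁺ p []       k = refl
  all≡true⁺ p (x ∷ xs) k = ∧≡true⁺ (k (here refl)) (all≡true⁺ p xs (λ m → k (there m)))

  all-++ : (p : A → Bool) → ∀ xs ys → all p (xs ++ ys) ≡ all p xs ∧ all p ys
  all-++ p []       ys = refl
  all-++ p (x ∷ xs) ys rewrite all-++ p xs ys = sym (∧-assoc (p x) _ _)

  remove : ∀ {x} (ys : List A) → x ∈ ys → List A
  remove (y ∷ ys) (here _)  = ys
  remove (y ∷ ys) (there p) = y ∷ remove ys p

  length-remove : ∀ {x} ys (p : x ∈ ys) → suc (length (remove ys p)) ≡ length ys
  length-remove (y ∷ ys) (here _)  = refl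
  length-remove (y ∷ ys) (there p) = cong suc (length-remove ys p)

  ∈-remove : ∀ {x z} ys (p : x ∈ ys) → z ∈ ys → z ≢ x → z ∈ remove ys p
  ∈-remove (y ∷ ys) (here refl) (here refl) z≢x = ⊥-elim (z≢x refl)
  ∈-remove (y ∷ ys) (here refl) (there q)   z≢x = q
  ∈-remove (y ∷ ys) (there p)   (here refl) z≢x = here refl
  ∈-remove (y ∷ ys) (there p)   (there q)   z≢x = there (∈-remove ys p q z≢x)

  Unique⇒length≤ : ∀ {xs ys} → Unique xs → xs ⊆ ys → length xs ≤ length ys
  Unique⇒length≤ {[]}     []             _  = z≤n
  Unique⇒length≤ {x ∷ xs} {ys} (x∉xs ∷ U) xs⊆ys =
    subst (suc (length xs) ≤_) (length-remove ys x∈ys)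
      (s≤s (Unique⇒length≤ U (λ z∈xs →
        ∈-remove ys x∈ys (xs⊆ys (there z∈xs)) (λ e → All-lookup x∉xs z∈xs (sym e)))))
    where x∈ys = xs⊆ys (here refl)

  AllPairs-map∈ : ∀ {R S : A → A → Set} {xs} →
                  (∀ {a b} → a ∈ xs → b ∈ xs → R a b → S a b) → AllPairs R xs → AllPairs S xs
  AllPairs-map∈ k []         = []
  AllPairs-map∈ k (px ∷ pxs) =
    tabulate (λ m → k (here refl) (there m) (All-lookup px m)) ∷
    AllPairs-map∈ (λ ma mb → k (there ma) (there mb)) pxs

  AllPairs-++∷⁻ˡ : ∀ {R : A → A → Set} pre {y ys w} → AllPairs R (pre ++ y ∷ ys) → w ∈ pre → R w y
  AllPairs-++∷⁻ˡ (a ∷ pre) (pa ∷ ps) (here refl) = All-lookup pa (∈-++⁺ʳ pre (here refl))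
  AllPairs-++∷⁻ˡ (a ∷ pre) (pa ∷ ps) (there m)   = AllPairs-++∷⁻ˡ pre ps m

  AllPairs-++∷⁻ʳ : ∀ {R : A → A → Set} pre {y ys w} → AllPairs R (pre ++ y ∷ ys) → w ∈ ys → R y w
  AllPairs-++∷⁻ʳ []        (py ∷ ps) m = All-lookup py m
  AllPairs-++∷⁻ʳ (a ∷ pre) (_ ∷ ps)  m = AllPairs-++∷⁻ʳ pre ps m

module CostBounds (h u σ : ℕ) where
  open +-*-Solver

  iterationCost : ℕ
  iterationCost = suc (suc (suc h)) * σ

  levelCost : ℕ
  levelCost = (u + 1) * σ + u * iterationCost

  delayBound : ℕ
  delayBound = 4 * ((h + 1) * (h + 1) * (u + 1) * σ)

  spaceBound : ℕ
  spaceBound = 4 * ((h + 1) * σ)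

  iteration-cost : ∀ k w → k ≤ suc h → σ + (k * σ + (σ + w)) ≤ w + iterationCost
  iteration-cost k w k≤ = ≤-trans
    (+-monoʳ-≤ σ (+-monoˡ-≤ (σ + w) (*-monoˡ-≤ σ k≤)))
    (≤-reflexive (solve 3 (λ s hh ww → s :+ ((s :+ hh :* s) :+ (s :+ ww))
                                     := ww :+ (s :+ (s :+ (s :+ hh :* s)))) refl σ h w))

  work-before-child : ∀ k w m B → k ≤ suc h → w + suc m * iterationCost ≤ B → k * σ + (σ + w) ≤ B
  work-before-child k w m B k≤ w≤ = ≤-trans (m≤n+m _ σ) (≤-trans (iteration-cost k w k≤)
    (≤-trans (+-monoʳ-≤ w (m≤m+n iterationCost (m * iterationCost))) w≤))

  work-skipping-child : ∀ k w m B → k ≤ suc h → w + suc m * iterationCost ≤ B →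
                        (σ + (k * σ + (σ + w))) + m * iterationCost ≤ B
  work-skipping-child k w m B k≤ w≤ =
    ≤-trans (+-monoˡ-≤ (m * iterationCost) (iteration-cost k w k≤))
      (≤-trans (≤-reflexive (+-assoc w iterationCost (m * iterationCost))) w≤)

  work-after-child : ∀ w m r → m ≤ u → w ≤ suc r * levelCost →
                     (σ + w) + m * iterationCost ≤ suc (suc r) * levelCost
  work-after-child w m r m≤u w≤ = ≤-trans
    (≤-reflexive (solve 3 (λ s ww mm → (s :+ ww) :+ mm := ww :+ (s :+ mm)) refl σ w (m * iterationCost)))
    (≤-trans (+-mono-≤ w≤ level) (≤-reflexive (+-comm (suc r * levelCost) levelCost)))
    where
    level : σ + m * iterationCost ≤ levelCost
    level = +-mono-≤ (≤-trans (≤-reflexive (sym (*-identityˡ σ))) (*-monoˡ-≤ σ (m≤n+m 1 u)))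
                     (*-monoˡ-≤ iterationCost m≤u)

  work-at-entry : ∀ m r → m ≤ u → u * σ + (σ + 0) + m * iterationCost ≤ suc r * levelCost
  work-at-entry m r m≤u = ≤-trans
    (≤-reflexive (solve 3 (λ uu s mm → uu :* s :+ (s :+ con 0) :+ mm := (uu :+ con 1) :* s :+ mm)
                          refl u σ (m * iterationCost)))
    (≤-trans (+-monoʳ-≤ ((u + 1) * σ) (*-monoˡ-≤ iterationCost m≤u)) (m≤m+n levelCost (r * levelCost)))

  queries-before-child : ∀ q m r → q + suc m ≤ r * u → r ≤ h → suc q ≤ h * u
  queries-before-child q m r q≤ r≤h =
    ≤-trans (≤-trans (s≤s (m≤m+n q m)) (≤-reflexive (sym (+-suc q m))))
            (≤-trans q≤ (*-monoˡ-≤ u r≤h))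

  queries-after-child : ∀ q m r → q ≤ r * u → m ≤ u → q + m ≤ suc r * u
  queries-after-child q m r q≤ m≤u = ≤-trans (+-mono-≤ q≤ m≤u) (≤-reflexive (+-comm (r * u) u))

  levelCost≤delayBound : ∀ r → r ≤ h → suc r * levelCost ≤ delayBound
  levelCost≤delayBound r r≤h = ≤-trans (*-monoˡ-≤ levelCost (s≤s r≤h))
    (≤-trans (m≤m+n (suc h * levelCost) ((h + 1) * σ * (3 * u * h + 4 * h + 3)))
      (≤-reflexive (solve 3 (λ hh uu s →
          (con 1 :+ hh) :* ((uu :+ con 1) :* s :+ uu :* ((con 1 :+ (con 1 :+ (con 1 :+ hh))) :* s))
          :+ (hh :+ con 1) :* s :* (con 3 :* uu :* hh :+ con 4 :* hh :+ con 3)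
          := con 4 :* ((hh :+ con 1) :* (hh :+ con 1) :* (uu :+ con 1) :* s)) refl h u σ)))

  memory≤spaceBound : ∀ d k → d ≤ h → k ≤ h → (suc d + k) * σ ≤ spaceBound
  memory≤spaceBound d k d≤h k≤h =
    ≤-trans (*-monoˡ-≤ σ frames) (≤-reflexive (*-assoc 4 (h + 1) σ))
    where
    frames : suc d + k ≤ 4 * (h + 1)
    frames = ≤-trans (+-mono-≤ (s≤s d≤h) k≤h)
      (≤-trans (m≤m+n (suc h + h) (2 * h + 3))
        (≤-reflexive (solve 1 (λ hh → (con 1 :+ hh :+ hh) :+ (con 2 :* hh :+ con 3)
                                    := con 4 :* (hh :+ con 1)) refl h)))

-- The local functions of pos, search and gaps (Defs) are not in scope.  They
-- are named here by metavariables, which the unfolding equations below solve;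
-- generalising over ucovers x and the empty list E makes the solution for
-- searchLoop the where-function itself, for arbitrary covers and E.
module Unfolding (L : FinLattice) (lex : List (FinLattice.Carrier L))
  (f : FinLattice.Carrier L → FinLattice.Carrier L) (u σ : ℕ) where
  open FinLattice L
  open Algorithm L lex f u σ

  private
    noPairs : List (Carrier × Carrier)
    noPairs = []

  mutual
    posFrom : List Carrier → List Carrier → Carrier → ℕ
    posFrom lex′ = _

    searchLoop : ℕ → ℕ → Carrier → List (Carrier × Carrier) → List Carrier →
                 List (Carrier × Carrier) → List (Event L)
    searchLoop n d x D = _

    gapsFrom : List (Event L) → List (Event L) → ℕ → ℕ → List (Seg L)
    gapsFrom t = _

    pos-∷ : ∀ y l w → Algorithm.pos L (y ∷ l) f u σ w ≡
            (if eqᵇ L w y then 0 else suc (posFrom (y ∷ l) l w))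
    pos-∷ y l w with y ∷ l
    ... | _ = refl

    search-suc : ∀ n d x D → search (suc n) d x D ≡ output x ∷ work σ ∷
                 memory ((suc d + length D) * σ) ∷ work (u * σ) ∷ searchLoop n d x D (ucovers x) []
    search-suc n d x D with ucovers x
    ... | _ with noPairs
    ... | _ = refl

    gaps-query : ∀ t → gaps L (query ∷ t) ≡ gapsFrom (query ∷ t) t 1 0
    gaps-query t with query ∷ t
    ... | _ with 1
    ... | _ with 0
    ... | _ = refl

module Order (L : FinLattice) where
  open FinLattice L
  open IsPartialOrder (IsLattice.isPartialOrder isLattice) public
    using () renaming (refl to ≼-refl; trans to ≼-trans; antisym to ≼-antisym)

  N : ℕ
  N = length elems

  _≟_ : (x y : Carrier) → Dec (x ≡ y)
  x ≟ y with x ≼? y | y ≼? x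
  ... | yes x≼y | yes y≼x = yes (≼-antisym x≼y y≼x)
  ... | no x⋠y  | _       = no (λ { refl → x⋠y ≼-refl })
  ... | yes _   | no y⋠x  = no (λ { refl → y⋠x ≼-refl })

  ≺-trans : ∀ {a b c} → _≺_ L a b → _≺_ L b c → _≺_ L a c
  ≺-trans (a≼b , a≢b) (b≼c , b≢c) =
    ≼-trans a≼b b≼c , λ { refl → a≢b (≼-antisym a≼b b≼c) }

  _≺?_ : (x y : Carrier) → Dec (_≺_ L x y)
  x ≺? y with x ≼? y | x ≟ y
  ... | yes x≼y | no x≢y = yes (x≼y , x≢y)
  ... | no x⋠y  | _      = no (λ p → x⋠y (proj₁ p))
  ... | yes _   | yes e  = no (λ p → proj₂ p e)

  leqᵇ-sound : ∀ {x y} → leqᵇ L x y ≡ true → x ≼ y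
  leqᵇ-sound {x} {y} with x ≼? y
  ... | yes x≼y = λ _ → x≼y
  ... | no _    = λ ()

  leqᵇ-complete : ∀ {x y} → x ≼ y → leqᵇ L x y ≡ true
  leqᵇ-complete {x} {y} x≼y with x ≼? y
  ... | yes _   = refl
  ... | no x⋠y  = ⊥-elim (x⋠y x≼y)

  leqᵇ-false : ∀ {x y} → ¬ x ≼ y → leqᵇ L x y ≡ false
  leqᵇ-false {x} {y} x⋠y with x ≼? y
  ... | yes x≼y = ⊥-elim (x⋠y x≼y)
  ... | no _    = refl

  eqᵇ-refl : ∀ x → eqᵇ L x x ≡ true
  eqᵇ-refl x = ∧≡true⁺ (leqᵇ-complete ≼-refl) (leqᵇ-complete ≼-refl)

  eqᵇ-false : ∀ {x y} → x ≢ y → eqᵇ L x y ≡ false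
  eqᵇ-false {x} {y} x≢y with x ≼? y | y ≼? x
  ... | yes x≼y | yes y≼x = ⊥-elim (x≢y (≼-antisym x≼y y≼x))
  ... | yes _   | no _    = refl
  ... | no _    | _       = refl

  ltᵇ-sound : ∀ {x y} → ltᵇ L x y ≡ true → _≺_ L x y
  ltᵇ-sound e with ∧≡true⁻ e
  ... | x≼y , y⋠x = leqᵇ-sound x≼y ,
    λ { refl → true≢false (trans (sym (leqᵇ-complete ≼-refl)) (not≡true⁻ y⋠x)) }

  ltᵇ-complete : ∀ {x y} → _≺_ L x y → ltᵇ L x y ≡ true
  ltᵇ-complete (x≼y , x≢y) rewrite leqᵇ-complete x≼y
    | leqᵇ-false (λ y≼x → x≢y (≼-antisym x≼y y≼x)) = refl

  private
    between : Carrier → Carrier → Carrier → Bool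
    between x y z = ltᵇ L x z ∧ ltᵇ L z y

  coverᵇ-sound : ∀ {x y} → coverᵇ L x y ≡ true → _⋖_ L x y
  coverᵇ-sound {x} {y} e with ∧≡true⁻ e
  ... | x≺y , nothing-between = ltᵇ-sound x≺y , λ { (z , x≺z , z≺y) →
      true≢false (trans (sym (∧≡true⁺ (ltᵇ-complete x≺z) (ltᵇ-complete z≺y)))
        (any≡false⁻ (between x y) elems (not≡true⁻ nothing-between) (complete z))) }

  coverᵇ-complete : ∀ {x y} → _⋖_ L x y → coverᵇ L x y ≡ true
  coverᵇ-complete {x} {y} (x≺y , nothing-between) rewrite ltᵇ-complete x≺y
    with any (between x y) elems in e
  ... | false = refl
  ... | true with any≡true⁻ (between x y) elems e
  ... | z , _ , bz with ∧≡true⁻ {ltᵇ L x z} bz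
  ... | x≺z , z≺y = ⊥-elim (nothing-between (z , ltᵇ-sound x≺z , ltᵇ-sound z≺y))

  Linked⇒Unique : ∀ {xs} → Linked (_≺_ L) xs → Unique xs
  Linked⇒Unique lk = AllPairs-map proj₂ (Linked⇒AllPairs ≺-trans lk)

  chain-length≤N : ∀ {xs} → Linked (_≺_ L) xs → length xs ≤ N
  chain-length≤N lk = Unique⇒length≤ (Linked⇒Unique lk) (λ {z} _ → complete z)

  -- Refine x ≺ z by inserting elements strictly between; the fuel k, together
  -- with the length of the chain built so far, exceeds N, so the refinement stops.
  private
    cover-below : ∀ {x} k z zs → Linked (_≺_ L) (z ∷ zs) → _≺_ L x z →
                  N < k + length (z ∷ zs) → ∃[ y ] (_⋖_ L x y × y ≼ z)
    cover-below zero z zs lk x≺z N< = ⊥-elim (<-irrefl refl (<-≤-trans N< (chain-length≤N lk)))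
    cover-below {x} (suc k) z zs lk x≺z N< with any? (λ w → (x ≺? w) ×-dec (w ≺? z)) elems
    ... | yes ∃w =
      let (w , x≺w , w≺z) = satisfied ∃w
          (y , x⋖y , y≼w) = cover-below k w (z ∷ zs) (w≺z ∷ lk) x≺w
                              (subst (N <_) (sym (+-suc k (length (z ∷ zs)))) N<)
      in y , x⋖y , ≼-trans y≼w (proj₁ w≺z)
    ... | no ∄w = z , (x≺z , λ { (w , x≺w , w≺z) → ∄w (lose (complete w) (x≺w , w≺z)) }) , ≼-refl

  cover-exists : ∀ {x z} → _≺_ L x z → ∃[ y ] (_⋖_ L x y × y ≼ z)
  cover-exists {z = z} x≺z = cover-below N z [] [-] x≺z (subst (N <_) (sym (+-comm N 1)) ≤-refl)

module Closure (L : FinLattice) {f : FinLattice.Carrier L → FinLattice.Carrier L}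
  (inc : Increasing L f) where
  open FinLattice L
  open Order L

  iter-increasing : ∀ n x → x ≼ iter L f n x
  iter-increasing zero    x = ≼-refl
  iter-increasing (suc n) x = ≼-trans (iter-increasing n x) (inc (iter L f n x))

  iter-least : Isotone L f → ∀ n {x p} → f p ≡ p → x ≼ p → iter L f n x ≼ p
  iter-least iso zero    fp x≼p = x≼p
  iter-least iso (suc n) {x} fp x≼p = subst (f (iter L f n x) ≼_) fp (iso (iter-least iso n fp x≼p))

  iter-stationary : ∀ i x → iter L f (suc i) x ≡ iter L f i x →
                    ∀ m → iter L f (suc (m + i)) x ≡ iter L f (m + i) x
  iter-stationary i x e zero    = e
  iter-stationary i x e (suc m) = cong f (iter-stationary i x e m)

  orbit : ℕ → ℕ → Carrier → List Carrier
  orbit k zero    x = iter L f k x ∷ []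
  orbit k (suc j) x = iter L f k x ∷ orbit (suc k) j x

  length-orbit : ∀ k j x → length (orbit k j x) ≡ suc j
  length-orbit k zero    x = refl
  length-orbit k (suc j) x = cong suc (length-orbit (suc k) j x)

  orbit-chain : ∀ k j x → (∀ i → i < k + j → _≺_ L (iter L f i x) (iter L f (suc i) x)) →
                Linked (_≺_ L) (orbit k j x)
  orbit-chain k zero          x step = [-]
  orbit-chain k (suc zero)    x step = step k (subst (k <_) (sym (+-comm k 1)) ≤-refl) ∷ [-]
  orbit-chain k (suc (suc j)) x step =
    step k (m<m+n k (s≤s z≤n)) ∷
    orbit-chain (suc k) (suc j) x (λ i i< → step i (subst (i <_) (sym (+-suc k (suc j))) i<))

  -- If f moved iter N x, the iterates 0..N would form a chain of N + 1 elements.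
  fstar-fixed : ∀ x → f (fstar L f x) ≡ fstar L f x
  fstar-fixed x with f (iter L f N x) ≟ iter L f N x
  ... | yes e    = e
  ... | no moved = ⊥-elim (<-irrefl refl
        (subst (_≤ N) (length-orbit 0 N x) (chain-length≤N (orbit-chain 0 N x step))))
    where
    step : ∀ i → i < 0 + N → _≺_ L (iter L f i x) (iter L f (suc i) x)
    step i i<N = inc (iter L f i x) , λ e → moved
      (subst (λ k → iter L f (suc k) x ≡ iter L f k x) (m∸n+n≡m (<⇒≤ i<N))
             (iter-stationary i x (sym e) (N ∸ i)))

  fstar-increasing : ∀ x → x ≼ fstar L f x
  fstar-increasing = iter-increasing N

  fstar-least : Isotone L f → ∀ {x p} → f p ≡ p → x ≼ p → fstar L f x ≼ p
  fstar-least iso = iter-least iso N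

module Covers (L : FinLattice) (lex : List (FinLattice.Carrier L)) (unique-lex : Unique lex)
  (∈lex : ∀ x → x ∈ lex) (f : FinLattice.Carrier L → FinLattice.Carrier L) (u σ : ℕ) where
  open FinLattice L
  open Algorithm L lex f u σ
  open Unfolding L lex f u σ
  open Order L

  private
    covers? : ∀ x w → Dec (T (coverᵇ L x w))
    covers? x w = T? (coverᵇ L x w)

  ucovers-sound : ∀ {x y} → y ∈ ucovers x → _⋖_ L x y
  ucovers-sound {x} m =
    coverᵇ-sound (Equivalence.to T-≡ (proj₂ (∈-filter⁻ (covers? x) {xs = lex} m)))

  ucovers-complete : ∀ {x y} → _⋖_ L x y → y ∈ ucovers x
  ucovers-complete {x} {y} x⋖y =
    ∈-filter⁺ (covers? x) (∈lex y) (Equivalence.from T-≡ (coverᵇ-complete x⋖y))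

  ucovers-unique : ∀ x → Unique (ucovers x)
  ucovers-unique x = Unique-filter⁺ (covers? x) unique-lex

  private
    posFrom-∷-≢ : ∀ lex′ y l {w} → w ≢ y → posFrom lex′ (y ∷ l) w ≡ suc (posFrom lex′ l w)
    posFrom-∷-≢ lex′ y l w≢y rewrite eqᵇ-false w≢y = refl

    posFrom-∷-≡ : ∀ lex′ y l → posFrom lex′ (y ∷ l) y ≡ 0
    posFrom-∷-≡ lex′ y l rewrite eqᵇ-refl y = refl

    posFrom-sorted : ∀ lex′ l → Unique l → AllPairs (λ a b → posFrom lex′ l a < posFrom lex′ l b) l
    posFrom-sorted lex′ []      []          = []
    posFrom-sorted lex′ (y ∷ l) (y∉l ∷ U) =
      tabulate (λ {b} b∈l → subst₂ _<_ (sym (posFrom-∷-≡ lex′ y l))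
                                      (sym (posFrom-∷-≢ lex′ y l (≢y b∈l))) (s≤s z≤n)) ∷
      AllPairs-map∈ (λ {a} {b} a∈l b∈l a<b →
          subst₂ _<_ (sym (posFrom-∷-≢ lex′ y l (≢y a∈l))) (sym (posFrom-∷-≢ lex′ y l (≢y b∈l)))
                 (s≤s a<b))
        (posFrom-sorted lex′ l U)
      where
      ≢y : ∀ {a} → a ∈ l → a ≢ y
      ≢y a∈l e = All-lookup y∉l a∈l (sym e)

  ucovers-sorted : ∀ x → AllPairs (λ a b → pos a < pos b) (ucovers x)
  ucovers-sorted x = AllPairs-filter⁺ (covers? x) (posFrom-sorted lex lex unique-lex)

  -- pos w ≤ pos v encodes w ⊑lex v.
  Outside : List (Carrier × Carrier) → Carrier → Set
  Outside D z = ∀ {a v w} → (a , v) ∈ D → w ∈ ucovers a → pos w ≤ pos v → ¬ w ≼ z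

  regionOK-sound : ∀ D {z} → regionOK D z ≡ true → Outside D z
  regionOK-sound D {z} ok {a} {v} {w} av∈D w∈ucov w≤v w≼z =
    true≢false (trans (sym w-ok)
      (cong not (∧≡true⁺ (Equivalence.to T-≡ (≤⇒≤ᵇ w≤v)) (leqᵇ-complete w≼z))))
    where
    w-ok : not (lexᵇ w v ∧ leqᵇ L w z) ≡ true
    w-ok = all≡true⁻ _ (ucovers a) (all≡true⁻ _ D ok av∈D) w∈ucov

  regionOK-complete : ∀ D {z} → Outside D z → regionOK D z ≡ true
  regionOK-complete D {z} out = all≡true⁺ _ D (λ { {a , v} av∈D → all≡true⁺ _ (ucovers a) (w-ok av∈D) })
    where
    w-ok : ∀ {a v w} → (a , v) ∈ D → w ∈ ucovers a → not (lexᵇ w v ∧ leqᵇ L w z) ≡ true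
    w-ok {a} {v} {w} av∈D w∈ucov with lexᵇ w v in w⊑v
    ... | false = refl
    ... | true with leqᵇ L w z in w≼z
    ... | false = refl
    ... | true  = ⊥-elim (out av∈D w∈ucov (≤ᵇ⇒≤ (pos w) (pos v) (Equivalence.from T-≡ w⊑v))
                              (leqᵇ-sound w≼z))

  Avoids : List Carrier → Carrier → Set
  Avoids pre z = ∀ {w} → w ∈ pre → ¬ w ≼ z

  -- As ucovers x is sorted by pos, its elements w ⊑lex y are exactly pre ++ [ y ].
  regionOK-cover⇔Avoids : ∀ {x pre y ys} → pre ++ y ∷ ys ≡ ucovers x → ∀ z →
                          regionOK [ (x , y) ] z ≡ true ⇔ Avoids (pre ++ [ y ]) z
  regionOK-cover⇔Avoids {x} {pre} {y} {ys} split z = mk⇔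
    (λ ok {w} w∈pre′ → regionOK-sound [ (x , y) ] ok (here refl)
                     (subst (w ∈_) (trans (++-assoc pre [ y ] ys) split) (∈-++⁺ˡ w∈pre′)) (⊑y w∈pre′))
    (λ avoids → regionOK-complete [ (x , y) ] {z}
                  λ { (here refl) w∈ucov w⊑y → avoids (⊑y⇒pre′ w∈ucov w⊑y) })
    where
    sorted : AllPairs (λ a b → pos a < pos b) (pre ++ y ∷ ys)
    sorted = subst (AllPairs (λ a b → pos a < pos b)) (sym split) (ucovers-sorted x)

    ⊑y : ∀ {w} → w ∈ pre ++ [ y ] → pos w ≤ pos y
    ⊑y w∈pre′ with ∈-++⁻ pre w∈pre′
    ... | inj₁ w∈pre       = <⇒≤ (AllPairs-++∷⁻ˡ pre sorted w∈pre)
    ... | inj₂ (here refl) = ≤-refl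

    ⊑y⇒pre′ : ∀ {w} → w ∈ ucovers x → pos w ≤ pos y → w ∈ pre ++ [ y ]
    ⊑y⇒pre′ {w} w∈ucov w⊑y with ∈-++⁻ pre (subst (w ∈_) (sym split) w∈ucov)
    ... | inj₁ w∈pre        = ∈-++⁺ˡ w∈pre
    ... | inj₂ (here refl)  = ∈-++⁺ʳ pre (here refl)
    ... | inj₂ (there w∈ys) = ⊥-elim (<-irrefl refl (<-≤-trans (AllPairs-++∷⁻ʳ pre sorted w∈ys) w⊑y))

  regionOK-++ : ∀ D E z → regionOK (D ++ E) z ≡ regionOK D z ∧ regionOK E z
  regionOK-++ D E z = all-++ _ D E

  regionOK-antitone : ∀ D {z z′} → regionOK D z′ ≡ true → z ≼ z′ → regionOK D z ≡ true
  regionOK-antitone D ok z≼z′ = regionOK-complete D (λ av∈D w∈ucov w≤v w≼z →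
    regionOK-sound D ok av∈D w∈ucov w≤v (≼-trans w≼z z≼z′))

module Correctness (L : FinLattice) (lex : List (FinLattice.Carrier L)) (unique-lex : Unique lex)
  (∈lex : ∀ x → x ∈ lex) (f : FinLattice.Carrier L → FinLattice.Carrier L)
  (iso : Isotone L f) (inc : Increasing L f) (h u : ℕ) (height : FixHeight L f h)
  (ucv : Ucv L u) (σ : ℕ) where
  open FinLattice L
  open Algorithm L lex f u σ
  open Unfolding L lex f u σ
  open Order L
  open Closure L inc
  open Covers L lex unique-lex ∈lex f u σ

  Pairs : Set
  Pairs = List (Carrier × Carrier)

  ucovers-length : ∀ x → length (ucovers x) ≤ u
  ucovers-length x = proj₂ ucv x (ucovers x) (ucovers-unique x) (tabulate ucovers-sound)

  ChainBound : ℕ → Carrier → Set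
  ChainBound k x = ∀ cs → IsFixChain L f (x ∷ cs) → length (x ∷ cs) ≤ k

  ChainBound-step : ∀ {k x z} → ChainBound (suc k) x → IsFixed L f x → _≺_ L x z →
                    IsFixed L f z → ChainBound k z
  ChainBound-step bound fx x≺z fz cs (fixed , linked) =
    ≤-pred (bound (_ ∷ cs) (fx ∷ fixed , x≺z ∷ linked))

  ChainBound-positive : ∀ {k x} → ChainBound k x → IsFixed L f x → 1 ≤ k
  ChainBound-positive bound fx = bound [] (fx ∷ [] , [-])

  below-closure-of-cover : ∀ {x y} → _⋖_ L x y → _≺_ L x (fstar L f y)
  below-closure-of-cover {y = y} ((x≼y , x≢y) , _) = ≼-trans x≼y (fstar-increasing y) ,
    λ e → x≢y (≼-antisym x≼y (subst (y ≼_) (sym e) (fstar-increasing y)))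

  -- The rank r is the height of Fix(f) still available above x; the fuel n
  -- only ensures termination, and never runs out.
  record Invariant (n d r : ℕ) (x : Carrier) (D : Pairs) : Set where
    field
      fixed      : IsFixed L f x
      outside    : regionOK D x ≡ true
      depth+rank : d + r ≡ h
      |D|≤depth  : length D ≤ d
      fuel-bound : ChainBound n x
      rank-bound : ChainBound (suc r) x
  open Invariant

  no-fuel : ∀ {d r x D} → ¬ Invariant zero d r x D
  no-fuel inv = <-irrefl refl (ChainBound-positive (fuel-bound inv) (fixed inv))

  rank-positive : ∀ {n d r x D y} → Invariant n d r x D → _⋖_ L x y → 1 ≤ r
  rank-positive {y = y} inv x⋖y = ChainBound-positive
    (ChainBound-step (rank-bound inv) (fixed inv) (below-closure-of-cover x⋖y) (fstar-fixed y))
    (fstar-fixed y)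

  depth≤h : ∀ {n d r x D} → Invariant n d r x D → d ≤ h
  depth≤h {d = d} {r} inv = subst (d ≤_) (depth+rank inv) (m≤m+n d r)

  rank≤h : ∀ {n d r x D} → Invariant n d r x D → r ≤ h
  rank≤h {d = d} {r} inv = subst (r ≤_) (depth+rank inv) (m≤n+m r d)

  |D++E|≤suc-h : ∀ {n d r x D} → Invariant n d r x D → ∀ {E : Pairs} → length E ≤ 1 →
                 length (D ++ E) ≤ suc h
  |D++E|≤suc-h {D = D} inv {E} |E|≤1 = subst (_≤ suc h) (sym (length-++ D))
    (subst (length D + length E ≤_) (+-comm h 1) (+-mono-≤ (≤-trans (|D|≤depth inv) (depth≤h inv)) |E|≤1))

  child-invariant : ∀ {n d r x D y E} → Invariant (suc n) d r x D → _⋖_ L x y →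
                    regionOK (D ++ E) (fstar L f y) ≡ true → length E ≤ 1 →
                    Σ ℕ (λ r′ → r ≡ suc r′ × Invariant n (suc d) r′ (fstar L f y) (D ++ E))
  child-invariant {r = zero} inv x⋖y _ _ = ⊥-elim (<-irrefl refl (rank-positive inv x⋖y))
  child-invariant {n} {d} {suc r′} {x} {D} {y} {E} inv x⋖y ok |E|≤1 = r′ , refl , record
    { fixed      = fstar-fixed y
    ; outside    = ok
    ; depth+rank = trans (sym (+-suc d r′)) (depth+rank inv)
    ; |D|≤depth  = subst (_≤ suc d) (sym (length-++ D))
                     (subst (length D + length E ≤_) (+-comm d 1) (+-mono-≤ (|D|≤depth inv) |E|≤1))
    ; fuel-bound = ChainBound-step (fuel-bound inv) (fixed inv) x≺y* (fstar-fixed y)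
    ; rank-bound = ChainBound-step (rank-bound inv) (fixed inv) x≺y* (fstar-fixed y)
    }
    where x≺y* = below-closure-of-cover x⋖y

  childCall : ℕ → ℕ → Carrier → Pairs → Carrier → Pairs → List (Event L)
  childCall n d x D y E =
    if regionOK (D ++ E) (fstar L f y) then search n (suc d) (fstar L f y) (D ++ E) else []

  outputs-++ : ∀ t₁ t₂ → outputs L (t₁ ++ t₂) ≡ outputs L t₁ ++ outputs L t₂
  outputs-++ []              t₂ = refl
  outputs-++ (output x ∷ t₁) t₂ = cong (x ∷_) (outputs-++ t₁ t₂)
  outputs-++ (query    ∷ t₁) t₂ = outputs-++ t₁ t₂
  outputs-++ (work _   ∷ t₁) t₂ = outputs-++ t₁ t₂
  outputs-++ (memory _ ∷ t₁) t₂ = outputs-++ t₁ t₂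

  outputs-work : ∀ k t → outputs L (replicate k (work σ) ++ t) ≡ outputs L t
  outputs-work zero    t = refl
  outputs-work (suc k) t = outputs-work k t

  outputs-loop : ∀ n d x D y ys E → outputs L (searchLoop n d x D (y ∷ ys) E) ≡
                 outputs L (childCall n d x D y E) ++ outputs L (searchLoop n d x D ys [ (x , y) ])
  outputs-loop n d x D y ys E =
    trans (outputs-work (length (D ++ E)) _) (outputs-++ (childCall n d x D y E) _)

  memories-++ : ∀ t₁ t₂ → memories L (t₁ ++ t₂) ≡ memories L t₁ ++ memories L t₂
  memories-++ []              t₂ = refl
  memories-++ (output _ ∷ t₁) t₂ = memories-++ t₁ t₂
  memories-++ (query    ∷ t₁) t₂ = memories-++ t₁ t₂
  memories-++ (work _   ∷ t₁) t₂ = memories-++ t₁ t₂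
  memories-++ (memory m ∷ t₁) t₂ = cong (m ∷_) (memories-++ t₁ t₂)

  memories-work : ∀ k t → memories L (replicate k (work σ) ++ t) ≡ memories L t
  memories-work zero    t = refl
  memories-work (suc k) t = memories-work k t

  memories-loop : ∀ n d x D y ys E → memories L (searchLoop n d x D (y ∷ ys) E) ≡
                  memories L (childCall n d x D y E) ++ memories L (searchLoop n d x D ys [ (x , y) ])
  memories-loop n d x D y ys E =
    trans (memories-work (length (D ++ E)) _) (memories-++ (childCall n d x D y E) _)

  FixedAbove : Pairs → Carrier → Carrier → Set
  FixedAbove D x z = IsFixed L f z × x ≼ z × regionOK D z ≡ true

  -- The fixed points the loop still has to output once the covers pre are
  -- treated and ys remain.
  Pending : Pairs → List Carrier → List Carrier → Carrier → Set
  Pending D pre ys z = IsFixed L f z × regionOK D z ≡ true × Avoids pre z × Any (_≼ z) ys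

  Enumerates : (Carrier → Set) → List (Event L) → Set
  Enumerates P t = Unique (outputs L t) × All P (outputs L t) × (∀ {z} → P z → z ∈ outputs L t)

  mutual
    search-enumerates : ∀ n d r x D → Invariant n d r x D → Enumerates (FixedAbove D x) (search n d x D)
    search-enumerates zero    d r x D inv = ⊥-elim (no-fuel inv)
    search-enumerates (suc n) d r x D inv =
      tabulate (λ m → x≢pending (All-lookup pending m)) ∷ unique ,
      (fixed inv , ≼-refl , outside inv) ∷ All-map fixedAbove pending ,
      complete′
      where
      loop = loop-enumerates n d r x D inv [] (ucovers x) [] refl z≤n (λ _ → mk⇔ (λ _ ()) (λ _ → refl))
      unique = proj₁ loop
      pending = proj₁ (proj₂ loop)

      x≢pending : ∀ {z} → Pending D [] (ucovers x) z → x ≢ z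
      x≢pending (_ , _ , _ , w≼z) refl with find w≼z
      ... | w , w∈ucov , w≼x with ucovers-sound w∈ucov
      ... | (x≼w , x≢w) , _ = x≢w (≼-antisym x≼w w≼x)

      fixedAbove : ∀ {z} → Pending D [] (ucovers x) z → FixedAbove D x z
      fixedAbove (fz , ok , _ , w≼z) with find w≼z
      ... | w , w∈ucov , w≼z′ = fz , ≼-trans (proj₁ (proj₁ (ucovers-sound w∈ucov))) w≼z′ , ok

      complete′ : ∀ {z} → FixedAbove D x z → z ∈ outputs L (search (suc n) d x D)
      complete′ {z} (fz , x≼z , ok) with x ≟ z
      ... | yes refl = here refl
      ... | no x≢z with cover-exists (x≼z , x≢z)
      ... | w , x⋖w , w≼z = there (proj₂ (proj₂ loop) (fz , ok , (λ ()) , lose (ucovers-complete x⋖w) w≼z))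

    -- pre ++ ys = ucovers x splits the covers into those treated and those
    -- pending; the region test against E is exactly "above no treated cover".
    loop-enumerates : ∀ n d r x D → Invariant (suc n) d r x D → ∀ pre ys E →
                      pre ++ ys ≡ ucovers x → length E ≤ 1 →
                      (∀ z → regionOK E z ≡ true ⇔ Avoids pre z) →
                      Enumerates (Pending D pre ys) (searchLoop n d x D ys E)
    loop-enumerates n d r x D inv pre [] E _ _ _ = [] , [] , λ { (_ , _ , _ , ()) }
    loop-enumerates n d r x D inv pre (y ∷ ys) E split |E|≤1 E⇔pre
      rewrite outputs-loop n d x D y ys E =
      Unique-++⁺ (proj₁ child) (proj₁ rest) disjoint ,
      All-++⁺ (All-map fromChild (proj₁ (proj₂ child))) (All-map fromRest (proj₁ (proj₂ rest))) ,
      complete′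
      where
      pre′ = pre ++ [ y ]

      x⋖y : _⋖_ L x y
      x⋖y = ucovers-sound (subst (y ∈_) split (∈-++⁺ʳ pre (here refl)))

      split′ : pre′ ++ ys ≡ ucovers x
      split′ = trans (++-assoc pre [ y ] ys) split

      rest = loop-enumerates n d r x D inv pre′ ys [ (x , y) ] split′ (s≤s z≤n)
               (regionOK-cover⇔Avoids split)

      child : Enumerates (FixedAbove (D ++ E) (fstar L f y)) (childCall n d x D y E)
      child with regionOK (D ++ E) (fstar L f y) in ok
      ... | true  = search-enumerates n (suc d) _ _ (D ++ E)
                      (proj₂ (proj₂ (child-invariant inv x⋖y ok |E|≤1)))
      ... | false = [] , [] , λ (_ , y*≼z , okz) →
                      ⊥-elim (true≢false (trans (sym (regionOK-antitone (D ++ E) okz y*≼z)) ok))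

      fromChild : ∀ {z} → FixedAbove (D ++ E) (fstar L f y) z → Pending D pre (y ∷ ys) z
      fromChild {z} (fz , y*≼z , ok) with ∧≡true⁻ {regionOK D z} (trans (sym (regionOK-++ D E z)) ok)
      ... | okD , okE = fz , okD , Equivalence.to (E⇔pre z) okE , here (≼-trans (fstar-increasing y) y*≼z)

      fromRest : ∀ {z} → Pending D pre′ ys z → Pending D pre (y ∷ ys) z
      fromRest (fz , okD , av , a) = fz , okD , (λ m → av (∈-++⁺ˡ m)) , there a

      disjoint : ∀ {v} → ¬ (v ∈ outputs L (childCall n d x D y E) ×
                            v ∈ outputs L (searchLoop n d x D ys [ (x , y) ]))
      disjoint (inChild , inRest) =
        proj₁ (proj₂ (proj₂ (All-lookup (proj₁ (proj₂ rest)) inRest))) (∈-++⁺ʳ pre (here refl))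
          (≼-trans (fstar-increasing y) (proj₁ (proj₂ (All-lookup (proj₁ (proj₂ child)) inChild))))

      complete′ : ∀ {z} → Pending D pre (y ∷ ys) z →
                  z ∈ outputs L (childCall n d x D y E) ++ outputs L (searchLoop n d x D ys [ (x , y) ])
      complete′ {z} (fz , okD , av , a) with y ≼? z
      ... | yes y≼z = ∈-++⁺ˡ (proj₂ (proj₂ child) (fz , fstar-least iso fz y≼z ,
                        trans (regionOK-++ D E z) (∧≡true⁺ okD (Equivalence.from (E⇔pre z) av))))
      ... | no y⋠z  = ∈-++⁺ʳ _ (proj₂ (proj₂ rest) (fz , okD , av′ , later a))
        where
        later : Any (_≼ z) (y ∷ ys) → Any (_≼ z) ys
        later (here y≼z) = ⊥-elim (y⋠z y≼z)
        later (there a′) = a′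
        av′ : Avoids pre′ z
        av′ m with ∈-++⁻ pre m
        ... | inj₁ w∈pre       = av w∈pre
        ... | inj₂ (here refl) = y⋠z

  open CostBounds h u σ

  WithinDelay : Seg L → Set
  WithinDelay g = proj₁ g ≤ h * u × proj₂ g ≤ delayBound

  covers≤rank*u : ∀ {n d r x D} → Invariant n d r x D → ∀ {ys} → All (_⋖_ L x) ys →
                  length ys ≤ u → length ys ≤ r * u
  covers≤rank*u inv []          _     = z≤n
  covers≤rank*u inv (x⋖y ∷ _)   |ys|≤u = ≤-trans |ys|≤u
    (≤-trans (≤-reflexive (sym (*-identityˡ u))) (*-monoˡ-≤ u (rank-positive inv x⋖y)))

  -- Each open call of rank r may still spend r * u queries and
  -- (r + 1) * levelCost work before control returns above it; a gap ends when
  -- a child call outputs its root, so the delay is bounded by the budget of h levels.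
  -- t₀ is the parameter that the local function of gaps inherits from its
  -- clause; it is never inspected.
  module Gaps (t₀ : List (Event L)) where
    G : List (Event L) → ℕ → ℕ → List (Seg L)
    G = gapsFrom t₀

    G-work : ∀ k t q w → G (replicate k (work σ) ++ t) q w ≡ G t q (k * σ + w)
    G-work zero    t q w = refl
    G-work (suc k) t q w = trans (G-work k t q (σ + w))
      (cong (G t q) (trans (sym (+-assoc (k * σ) σ w)) (cong (_+ w) (+-comm (k * σ) σ))))

    G-loop : ∀ n d x D y ys E rest q w → G (searchLoop n d x D (y ∷ ys) E ++ rest) q w ≡
             G (childCall n d x D y E ++ (work σ ∷ (searchLoop n d x D ys [ (x , y) ] ++ rest)))
               (suc q) (length (D ++ E) * σ + (σ + w))
    G-loop n d x D y ys E rest q w =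
      trans (cong (λ t → G t (suc q) (σ + w))
              (++-assoc (replicate (length (D ++ E)) (work σ))
                        (childCall n d x D y E ++ (work σ ∷ searchLoop n d x D ys [ (x , y) ])) rest))
      (trans (G-work (length (D ++ E)) _ (suc q) (σ + w))
        (cong (λ t → G t (suc q) (length (D ++ E) * σ + (σ + w)))
          (++-assoc (childCall n d x D y E) (work σ ∷ searchLoop n d x D ys [ (x , y) ]) rest)))

    Continuation : ℕ → List (Event L) → Set
    Continuation r rest = ∀ q w → q ≤ r * u → w ≤ suc r * levelCost → All WithinDelay (G rest q w)

    mutual
      search-gaps : ∀ n d r x D → Invariant n d r x D → ∀ rest q w → WithinDelay (q , w) →
                    Continuation r rest → All WithinDelay (G (search n d x D ++ rest) q w)
      search-gaps zero    d r x D inv rest q w _ _ = ⊥-elim (no-fuel inv)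
      search-gaps (suc n) d r x D inv rest q w current k =
        current ∷ loop-gaps n d r x D inv (ucovers x) [] covers (ucovers-length x) z≤n
                    rest 0 (u * σ + (σ + 0))
                    (covers≤rank*u inv covers (ucovers-length x))
                    (work-at-entry (length (ucovers x)) r (ucovers-length x)) k
        where covers = tabulate ucovers-sound

      loop-gaps : ∀ n d r x D → Invariant (suc n) d r x D → ∀ ys E → All (_⋖_ L x) ys →
                  length ys ≤ u → length E ≤ 1 → ∀ rest q w →
                  q + length ys ≤ r * u → w + length ys * iterationCost ≤ suc r * levelCost →
                  Continuation r rest → All WithinDelay (G (searchLoop n d x D ys E ++ rest) q w)
      loop-gaps n d r x D inv [] E _ _ _ rest q w q≤ w≤ k =
        k q w (subst (_≤ r * u) (+-identityʳ q) q≤) (subst (_≤ suc r * levelCost) (+-identityʳ w) w≤)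
      loop-gaps n d r x D inv (y ∷ ys) E (x⋖y ∷ x⋖ys) |ys|≤u |E|≤1 rest q w q≤ w≤ k
        rewrite G-loop n d x D y ys E rest q w with regionOK (D ++ E) (fstar L f y) in ok
      ... | false =
        loop-gaps n d r x D inv ys [ (x , y) ] x⋖ys (≤-trans (n≤1+n _) |ys|≤u) (s≤s z≤n) rest (suc q)
          (σ + (length (D ++ E) * σ + (σ + w)))
          (subst (_≤ r * u) (+-suc q (length ys)) q≤)
          (work-skipping-child (length (D ++ E)) w (length ys) (suc r * levelCost)
             (|D++E|≤suc-h inv |E|≤1) w≤)
          k
      ... | true with child-invariant inv x⋖y ok |E|≤1
      ... | r′ , refl , inv′ =
        search-gaps n (suc d) r′ (fstar L f y) (D ++ E) inv′
          (work σ ∷ (searchLoop n d x D ys [ (x , y) ] ++ rest)) (suc q) (length (D ++ E) * σ + (σ + w))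
          (queries-before-child q (length ys) (suc r′) q≤ (rank≤h inv) ,
           work-before-child (length (D ++ E)) w (length ys) delayBound (|D++E|≤suc-h inv |E|≤1)
             (≤-trans w≤ (levelCost≤delayBound (suc r′) (rank≤h inv))))
          (λ q′ w′ q′≤ w′≤ → loop-gaps n d (suc r′) x D inv ys [ (x , y) ] x⋖ys |ys|≤u′ (s≤s z≤n) rest
             q′ (σ + w′) (queries-after-child q′ (length ys) r′ q′≤ |ys|≤u′)
             (work-after-child w′ (length ys) r′ |ys|≤u′ w′≤) k)
        where |ys|≤u′ = ≤-trans (n≤1+n _) |ys|≤u

  mutual
    search-memory : ∀ n d r x D → Invariant n d r x D → All (_≤ spaceBound) (memories L (search n d x D))
    search-memory zero    d r x D inv = ⊥-elim (no-fuel inv)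
    search-memory (suc n) d r x D inv =
      memory≤spaceBound d (length D) (depth≤h inv) (≤-trans (|D|≤depth inv) (depth≤h inv)) ∷
      loop-memory n d r x D inv (ucovers x) [] (tabulate ucovers-sound) z≤n

    loop-memory : ∀ n d r x D → Invariant (suc n) d r x D → ∀ ys E → All (_⋖_ L x) ys →
                  length E ≤ 1 → All (_≤ spaceBound) (memories L (searchLoop n d x D ys E))
    loop-memory n d r x D inv []       E _ _ = []
    loop-memory n d r x D inv (y ∷ ys) E (x⋖y ∷ x⋖ys) |E|≤1 rewrite memories-loop n d x D y ys E
      with regionOK (D ++ E) (fstar L f y) in ok
    ... | false = loop-memory n d r x D inv ys [ (x , y) ] x⋖ys (s≤s z≤n)
    ... | true with child-invariant inv x⋖y ok |E|≤1
    ... | r′ , refl , inv′ = All-++⁺ (search-memory n (suc d) r′ (fstar L f y) (D ++ E) inv′)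
                                     (loop-memory n d (suc r′) x D inv ys [ (x , y) ] x⋖ys (s≤s z≤n))

  module Run (s : Carrier) where
    root : Carrier
    root = fstar L f s

    trace : List (Event L)
    trace = search (suc N) 0 root []

    root-invariant : Invariant (suc N) 0 h root []
    root-invariant = record
      { fixed      = fstar-fixed s
      ; outside    = refl
      ; depth+rank = refl
      ; |D|≤depth  = z≤n
      ; fuel-bound = λ cs chain → ≤-trans (chain-length≤N (proj₂ chain)) (n≤1+n N)
      ; rank-bound = λ cs chain → proj₂ height (root ∷ cs) chain
      }

    enumerates : EnumeratesFixAbove L f s (outputs L trace)
    enumerates with search-enumerates (suc N) 0 h root [] root-invariant
    ... | unique , sound , complete′ =
      unique ,
      All-map (λ (fz , root≼z , _) → fz , ≼-trans (fstar-increasing s) root≼z) sound ,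
      λ z fz s≼z → complete′ (fz , fstar-least iso fz s≼z , refl)

    delay : All WithinDelay (gaps L trace)
    delay = subst (λ t → All WithinDelay (gapsFrom trace t 0 0)) (++-identityʳ trace)
      (Gaps.search-gaps trace (suc N) 0 h root [] root-invariant [] 0 0 (z≤n , z≤n)
        (λ q w q≤ w≤ → (q≤ , ≤-trans w≤ (levelCost≤delayBound h ≤-refl)) ∷ []))

    space : All (_≤ spaceBound) (memories L trace)
    space = search-memory (suc N) 0 h root [] root-invariant

theorem5 : ∃[ c ] ((L : FinLattice) → (lex : List (FinLattice.Carrier L)) →
    Unique lex → (∀ x → x ∈ lex) →
    (f : FinLattice.Carrier L → FinLattice.Carrier L) →
    Isotone L f → Increasing L f → (s : FinLattice.Carrier L) →
    (h u : ℕ) → FixHeight L f h → Ucv L u → (σ : ℕ) →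
    EnumeratesFixAbove L f s (outputs L (Algorithm.run L lex f u σ s)) ×
    All (λ { (q , w) → q ≤ h * u × w ≤ c * ((h + 1) * (h + 1) * (u + 1) * σ) })
      (gaps L (Algorithm.run L lex f u σ s)) ×
    All (λ m → m ≤ c * ((h + 1) * σ)) (memories L (Algorithm.run L lex f u σ s)))
theorem5 = 4 , λ L lex unique-lex ∈lex f iso inc s h u height ucv σ →
  let open Correctness L lex unique-lex ∈lex f iso inc h u height ucv σ
      open Run s
  in enumerates , delay , space
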